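{- Let $\pi\in\mathcal{S}_n$ be such that $G:=C(\pi)$ has exactly one connected component $C_1$ with at least two vertices, and $G$ does not contain $P_3$ (the path with $4$ vertices) as an induced subgraph. Then there exists a vertex $v\in C_1$ adjacent to every vertex of $C_1\setminus\{v\}$.
   Context: For $\pi=\pi_1\cdots\pi_n\in\mathcal{S}_n$, $C(\pi)$ is the simple graph on vertex set $\{1,\dots,n\}$ in which distinct $i,j$ are adjacent iff there exists $k$ with $k<i$, $k<j$, $\pi_k<\pi_i$ and $\pi_k<\pi_j$ (the competition graph of the digraph with an arc from $j$ to $i$ whenever $i<j$ and $\pi_i<\pi_j$). -}

module Defs where

open import Data.Nat using (ℕ)
open import Data.Fin using (Fin; _<_)
open import Data.Fin.Permutation using (Permutation′; _⟨$⟩ʳ_)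
open import Data.Product using (Σ; ∃; _×_; _,_)
open import Relation.Binary.PropositionalEquality using (_≡_; _≢_)
open import Relation.Nullary using (¬_)
open import Relation.Binary.Construct.Closure.ReflexiveTransitive using (Star)

-- Positions 1..n are represented by Fin n (0-based); π i is the value at position i.
-- Competition graph C(π): distinct i, j adjacent iff some k < i, k < j
-- with π k < π i and π k < π j.
Adj : ∀ {n} → Permutation′ n → Fin n → Fin n → Set
Adj π i j = (i ≢ j) × ∃ λ k → (k < i) × (k < j) × ((π ⟨$⟩ʳ k) < (π ⟨$⟩ʳ i)) × ((π ⟨$⟩ʳ k) < (π ⟨$⟩ʳ j))

Connected : ∀ {n} → Permutation′ n → Fin n → Fin n → Set
Connected π = Star (Adj π)

-- A vertex lies in a connected component with at least two vertices
-- iff it has a neighbour.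
NonIsolated : ∀ {n} → Permutation′ n → Fin n → Set
NonIsolated π x = ∃ λ y → Adj π x y

-- C(π) has exactly one connected component with at least two vertices:
-- there is a non-isolated vertex c, and every non-isolated vertex is
-- in the component of c.
UniqueNontrivialComponent : ∀ {n} → Permutation′ n → Fin n → Set
UniqueNontrivialComponent π c = NonIsolated π c × (∀ x → NonIsolated π x → Connected π c x)

HasInducedP3 : ∀ {n} → Permutation′ n → Set
HasInducedP3 {n} π = Σ (Fin n) λ a → Σ (Fin n) λ b → Σ (Fin n) λ c → Σ (Fin n) λ d →
  (a ≢ b) × (a ≢ c) × (a ≢ d) × (b ≢ c) × (b ≢ d) × (c ≢ d) ×
  Adj π a b × Adj π b c × Adj π c d ×
  ¬ Adj π a c × ¬ Adj π a d × ¬ Adj π b d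

module Submission where

-- Write N[v] for the closed neighbourhood {v} ∪ {x | v ~ x} of a vertex v.
--
-- 1. Graphs without induced P₄ and C₄.  If v ~ w, y ∈ N[w] ∖ N[v] and
--    x ∈ N[v] ∖ N[w], then x v w y is an induced P₄ (if x ≁ y) or an induced
--    C₄ (if x ~ y).  So adjacent vertices have ⊆-comparable closed
--    neighbourhoods, and if |N[v]| is at least |N[x]| for every neighbour x
--    of v, then N[v] is closed under adjacency and contains the component of v.
-- 2. Competition graphs.  Two neighbours of s that both come after s are
--    adjacent: whichever of the two witnesses has the smaller value serves
--    for both.  Hence on an induced 4-cycle of C(π) every vertex has a cycle
--    neighbour preceding it, which is impossible; C(π) has no induced C₄.
-- 3. Main theorem.  Take a non-isolated v maximising |N[v]|.  By uniqueness of
--    the nontrivial component, v lies in the component of c₁, and by 1 and 2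
--    it is adjacent to every other vertex of that component.

open import Defs
open import Data.Nat using (ℕ)
open import Data.Fin using (Fin)
open import Data.Fin.Permutation using (Permutation′)
open import Data.Product using (Σ; ∃; _×_; _,_)
open import Relation.Binary.PropositionalEquality using (_≢_)
open import Relation.Nullary using (¬_)

open import Data.Nat using (_≤_)
import Data.Nat.Properties as ℕ
open import Data.Fin using (_<_)
open import Data.Fin.Permutation using (_⟨$⟩ʳ_)
import Data.Fin.Properties as Fin
open import Data.Fin.Subset using (Subset; _∈_; _⊆_; _⊂_; ∣_∣)
open import Data.Fin.Subset.Properties using (p⊂q⇒∣p∣<∣q∣)
open import Data.Vec using (tabulate)
open import Data.Vec.Properties using (lookup∘tabulate; lookup⇒[]=; []=⇒lookup)
open import Data.List using (List; filter; allFin)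
import Data.List.Relation.Unary.All as All
open import Data.List.Relation.Unary.All.Properties using (all-filter)
open import Data.List.Membership.Propositional.Properties using (∈-filter⁺; ∈-allFin)
open import Data.List.Extrema.Nat using (argmax; argmax-all; f[xs]≤f[argmax])
open import Data.Product using (proj₁; proj₂)
open import Data.Sum using (_⊎_; inj₁; inj₂)
open import Data.Empty using (⊥; ⊥-elim)
open import Function using (_∘_)
open import Relation.Binary.PropositionalEquality using (_≡_; refl; sym; trans)
open import Relation.Nullary using (Dec; yes; no; does)
open import Relation.Nullary.Decidable using (dec-true; _×-dec_)
open import Relation.Unary using (Decidable)
open import Relation.Binary.Construct.Closure.ReflexiveTransitive
  using (Star; ε; _◅_; _◅◅_; reverse)

module _ {n : ℕ} where

  toSubset : {P : Fin n → Set} → Decidable P → Subset n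
  toSubset P? = tabulate (does ∘ P?)

  ∈-toSubset⁺ : {P : Fin n → Set} (P? : Decidable P) {x : Fin n} → P x → x ∈ toSubset P?
  ∈-toSubset⁺ P? {x} px =
    lookup⇒[]= x (toSubset P?) (trans (lookup∘tabulate (does ∘ P?) x) (dec-true (P? x) px))

  ∈-toSubset⁻ : {P : Fin n → Set} (P? : Decidable P) {x : Fin n} → x ∈ toSubset P? → P x
  ∈-toSubset⁻ P? {x} x∈p with P? x | trans (sym (lookup∘tabulate (does ∘ P?) x)) ([]=⇒lookup x∈p)
  ... | yes px | _ = px
  ... | no _   | ()

  maximiser : {P : Fin n → Set} → Decidable P → (f : Fin n → ℕ) → {c : Fin n} → P c →
    ∃ λ v → P v × (∀ x → P x → f x ≤ f v)
  maximiser {P} P? f {c} pc = v , argmax-all f pc (all-filter P? (allFin n)) , v-maximal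
    where
    candidates : List (Fin n)
    candidates = filter P? (allFin n)
    v : Fin n
    v = argmax f c candidates
    v-maximal : ∀ x → P x → f x ≤ f v
    v-maximal x px = All.lookup (f[xs]≤f[argmax] c candidates) (∈-filter⁺ P? (∈-allFin x) px)

module Graph {n : ℕ} (_~_ : Fin n → Fin n → Set) (_~?_ : ∀ x y → Dec (x ~ y))
             (~-sym : ∀ {x y} → x ~ y → y ~ x) (~-irrefl : ∀ {x y} → x ~ y → x ≢ y) where

  _∈N[_] : Fin n → Fin n → Set
  x ∈N[ v ] = x ≡ v ⊎ v ~ x

  _∈N[_]? : ∀ x v → Dec (x ∈N[ v ])
  x ∈N[ v ]? with x Fin.≟ v | v ~? x
  ... | yes x≡v | _      = yes (inj₁ x≡v)
  ... | no _    | yes v~x = yes (inj₂ v~x)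
  ... | no x≢v  | no v≁x  = no λ { (inj₁ x≡v) → x≢v x≡v ; (inj₂ v~x) → v≁x v~x }

  N[_] : Fin n → Subset n
  N[ v ] = toSubset (_∈N[ v ]?)

  InducedP4 : Set
  InducedP4 = Σ (Fin n) λ a → Σ (Fin n) λ b → Σ (Fin n) λ c → Σ (Fin n) λ d →
    (a ≢ b) × (a ≢ c) × (a ≢ d) × (b ≢ c) × (b ≢ d) × (c ≢ d) ×
    a ~ b × b ~ c × c ~ d × ¬ a ~ c × ¬ a ~ d × ¬ b ~ d

  -- A cycle a-b-c-d-a without chords; the sides are distinct by irreflexivity.
  InducedC4 : Set
  InducedC4 = Σ (Fin n) λ a → Σ (Fin n) λ b → Σ (Fin n) λ c → Σ (Fin n) λ d →
    (a ≢ c) × (b ≢ d) × a ~ b × b ~ c × c ~ d × d ~ a × ¬ a ~ c × ¬ b ~ d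

  module _ (noP4 : ¬ InducedP4) (noC4 : ¬ InducedC4) where

    comparable : ∀ {v w y} → v ~ w → y ∈N[ w ] → ¬ y ∈N[ v ] → ∀ x → x ∈N[ v ] → x ∈N[ w ]
    comparable {v} {w} {y} v~w y∈Nw y∉Nv x x∈Nv with x ∈N[ w ]?
    ... | yes x∈Nw = x∈Nw
    ... | no x∉Nw = ⊥-elim P4-or-C4
      where
      neighbour : ∀ {a b} → a ∈N[ b ] → a ≢ b → b ~ a
      neighbour (inj₁ a≡b) a≢b = ⊥-elim (a≢b a≡b)
      neighbour (inj₂ b~a) _   = b~a
      v~x : v ~ x
      v~x = neighbour x∈Nv λ { refl → x∉Nw (inj₂ (~-sym v~w)) }
      w~y : w ~ y
      w~y = neighbour y∈Nw λ { refl → y∉Nv (inj₂ v~w) }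
      x≢w : x ≢ w
      x≢w x≡w = x∉Nw (inj₁ x≡w)
      x≁w : ¬ x ~ w
      x≁w x~w = x∉Nw (inj₂ (~-sym x~w))
      v≢y : v ≢ y
      v≢y v≡y = y∉Nv (inj₁ (sym v≡y))
      v≁y : ¬ v ~ y
      v≁y v~y = y∉Nv (inj₂ v~y)
      P4-or-C4 : ⊥
      P4-or-C4 with x ~? y
      ... | yes x~y = noC4 (x , v , w , y , x≢w , v≢y , ~-sym v~x , v~w , w~y , ~-sym x~y , x≁w , v≁y)
      ... | no x≁y = noP4 (x , v , w , y , ~-irrefl (~-sym v~x) , x≢w , (λ { refl → v≁y v~x }) ,
                          ~-irrefl v~w , v≢y , ~-irrefl w~y ,
                          ~-sym v~x , v~w , w~y , x≁w , x≁y , v≁y)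

    -- If no neighbour of v has a larger closed neighbourhood, then N[v]
    -- absorbs the closed neighbourhood of each neighbour of v (else the two
    -- would be strictly nested the wrong way).
    absorbs : ∀ {v} → (∀ x → v ~ x → ∣ N[ x ] ∣ ≤ ∣ N[ v ] ∣) →
      ∀ {x y} → v ~ x → y ∈N[ x ] → y ∈N[ v ]
    absorbs {v} v-max {x} {y} v~x y∈Nx with y ∈N[ v ]?
    ... | yes y∈Nv = y∈Nv
    ... | no y∉Nv = ⊥-elim (ℕ.<⇒≱ (p⊂q⇒∣p∣<∣q∣ Nv⊂Nx) (v-max x v~x))
      where
      Nv⊆Nx : N[ v ] ⊆ N[ x ]
      Nv⊆Nx {z} = ∈-toSubset⁺ (_∈N[ x ]?) ∘ comparable v~x y∈Nx y∉Nv z ∘ ∈-toSubset⁻ (_∈N[ v ]?)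
      Nv⊂Nx : N[ v ] ⊂ N[ x ]
      Nv⊂Nx = Nv⊆Nx , y , ∈-toSubset⁺ (_∈N[ x ]?) y∈Nx , y∉Nv ∘ ∈-toSubset⁻ (_∈N[ v ]?)

    reachable⊆N : ∀ {v} → (∀ x → v ~ x → ∣ N[ x ] ∣ ≤ ∣ N[ v ] ∣) →
      ∀ {x z} → Star _~_ x z → x ∈N[ v ] → z ∈N[ v ]
    reachable⊆N v-max ε         z∈Nv        = z∈Nv
    reachable⊆N v-max (v~y ◅ p) (inj₁ refl) = reachable⊆N v-max p (inj₂ v~y)
    reachable⊆N v-max (x~y ◅ p) (inj₂ v~x)  = reachable⊆N v-max p (absorbs v-max v~x (inj₂ x~y))

-- The order on Fin m admits no 4-cycle in which every element has a smaller
-- cycle neighbour: following the smaller neighbours yields a descending cycle.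
no-descending-4-cycle : ∀ {m} {a b c d : Fin m} →
  (b < a ⊎ d < a) → (a < b ⊎ c < b) → (b < c ⊎ d < c) → (c < d ⊎ a < d) → ⊥
no-descending-4-cycle (inj₁ b<a) (inj₁ a<b) _          _          = Fin.<-asym b<a a<b
no-descending-4-cycle (inj₁ b<a) (inj₂ c<b) (inj₁ b<c) _          = Fin.<-asym c<b b<c
no-descending-4-cycle (inj₁ b<a) (inj₂ c<b) (inj₂ d<c) (inj₁ c<d) = Fin.<-asym d<c c<d
no-descending-4-cycle (inj₁ b<a) (inj₂ c<b) (inj₂ d<c) (inj₂ a<d) =
  Fin.<-asym (Fin.<-trans d<c (Fin.<-trans c<b b<a)) a<d
no-descending-4-cycle (inj₂ d<a) _          _          (inj₂ a<d) = Fin.<-asym d<a a<d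
no-descending-4-cycle (inj₂ d<a) (inj₁ a<b) (inj₁ b<c) (inj₁ c<d) =
  Fin.<-asym (Fin.<-trans a<b (Fin.<-trans b<c c<d)) d<a
no-descending-4-cycle (inj₂ d<a) (inj₂ c<b) (inj₁ b<c) (inj₁ c<d) = Fin.<-asym c<b b<c
no-descending-4-cycle (inj₂ d<a) _          (inj₂ d<c) (inj₁ c<d) = Fin.<-asym d<c c<d

module CompetitionGraph {n : ℕ} (π : Permutation′ n) where

  adj-sym : ∀ {i j} → Adj π i j → Adj π j i
  adj-sym (i≢j , k , k<i , k<j , πk<πi , πk<πj) = i≢j ∘ sym , k , k<j , k<i , πk<πj , πk<πi

  adj-irrefl : ∀ {i j} → Adj π i j → i ≢ j
  adj-irrefl = proj₁

  adj? : ∀ i j → Dec (Adj π i j)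
  adj? i j with i Fin.≟ j
  ... | yes i≡j = no λ adj → proj₁ adj i≡j
  ... | no i≢j with Fin.any? common-witness?
    where
    common-witness? : ∀ k → Dec ((k < i) × (k < j) × (π ⟨$⟩ʳ k < π ⟨$⟩ʳ i) × (π ⟨$⟩ʳ k < π ⟨$⟩ʳ j))
    common-witness? k =
      k Fin.<? i ×-dec k Fin.<? j ×-dec π ⟨$⟩ʳ k Fin.<? π ⟨$⟩ʳ i ×-dec π ⟨$⟩ʳ k Fin.<? π ⟨$⟩ʳ j
  ... | yes witness = yes (i≢j , witness)
  ... | no none = no (none ∘ proj₂)

  -- Neighbours of s that both come after s are adjacent: the witness with
  -- the smaller π-value lies below both of them.
  later-neighbours-adjacent : ∀ {s a b} → s < a → s < b → a ≢ b → Adj π s a → Adj π s b → Adj π a b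
  later-neighbours-adjacent s<a s<b a≢b
    (_ , k , k<s , _ , _ , πk<πa) (_ , k′ , k′<s , _ , _ , πk′<πb) with π ⟨$⟩ʳ k Fin.≤? π ⟨$⟩ʳ k′
  ... | yes πk≤πk′ = a≢b , k , ℕ.<-trans k<s s<a , ℕ.<-trans k<s s<b , πk<πa , ℕ.≤-<-trans πk≤πk′ πk′<πb
  ... | no πk≰πk′ = a≢b , k′ , ℕ.<-trans k′<s s<a , ℕ.<-trans k′<s s<b ,
                    ℕ.<-trans (ℕ.≰⇒> πk≰πk′) πk<πa , πk′<πb

  nonadjacent-neighbour-precedes : ∀ {s a b} → a ≢ b → Adj π s a → Adj π s b → ¬ Adj π a b →
    (a < s) ⊎ (b < s)
  nonadjacent-neighbour-precedes {s} {a} {b} a≢b s~a s~b a≁b with a Fin.<? s | b Fin.<? s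
  ... | yes a<s | _       = inj₁ a<s
  ... | no _    | yes b<s = inj₂ b<s
  ... | no a≮s  | no b≮s  =
    ⊥-elim (a≁b (later-neighbours-adjacent (after a≮s s~a) (after b≮s s~b) a≢b s~a s~b))
    where
    after : ∀ {x} → ¬ x < s → Adj π s x → s < x
    after x≮s s~x = Fin.≤∧≢⇒< (ℕ.≮⇒≥ x≮s) (proj₁ s~x)

  nonisolated? : ∀ x → Dec (NonIsolated π x)
  nonisolated? x = Fin.any? (adj? x)

  open Graph (Adj π) adj? adj-sym adj-irrefl public

  -- At each vertex of an induced 4-cycle one of its two cycle neighbours
  -- precedes it, which no strict order allows.
  no-induced-C4 : ¬ InducedC4
  no-induced-C4 (a , b , c , d , a≢c , b≢d , a~b , b~c , c~d , d~a , a≁c , b≁d) =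
    no-descending-4-cycle
      (nonadjacent-neighbour-precedes b≢d a~b (adj-sym d~a) b≁d)
      (nonadjacent-neighbour-precedes a≢c (adj-sym a~b) b~c a≁c)
      (nonadjacent-neighbour-precedes b≢d (adj-sym b~c) c~d b≁d)
      (nonadjacent-neighbour-precedes (a≢c ∘ sym) (adj-sym c~d) d~a (a≁c ∘ adj-sym))

mainTheorem7 : (n : ℕ) (π : Permutation′ n) (c₁ : Fin n) →
    UniqueNontrivialComponent π c₁ → ¬ HasInducedP3 π →
    ∃ λ v → Connected π c₁ v × (∀ w → Connected π c₁ w → w ≢ v → Adj π v w)
mainTheorem7 n π c₁ (c₁-nonisolated , in-component) noP3 = v , c₁⇝v , v-universal
  where
  open CompetitionGraph π
  maximum : ∃ λ v → NonIsolated π v × (∀ x → NonIsolated π x → ∣ N[ x ] ∣ ≤ ∣ N[ v ] ∣)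
  maximum = maximiser nonisolated? (λ x → ∣ N[ x ] ∣) c₁-nonisolated
  v : Fin n
  v = proj₁ maximum
  v-max : ∀ x → Adj π v x → ∣ N[ x ] ∣ ≤ ∣ N[ v ] ∣
  v-max x v~x = proj₂ (proj₂ maximum) x (v , adj-sym v~x)
  c₁⇝v : Connected π c₁ v
  c₁⇝v = in-component v (proj₁ (proj₂ maximum))
  v⇝w : ∀ {w} → Connected π c₁ w → Connected π v w
  v⇝w c₁⇝w = reverse adj-sym c₁⇝v ◅◅ c₁⇝w
  v-universal : ∀ w → Connected π c₁ w → w ≢ v → Adj π v w
  v-universal w c₁⇝w w≢v with reachable⊆N noP3 no-induced-C4 v-max (v⇝w c₁⇝w) (inj₁ refl)
  ... | inj₁ w≡v = ⊥-elim (w≢v w≡v)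
  ... | inj₂ v~w = v~w
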